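{- In any weak AMD code with $m\ge 2$ sources, in which $a$ denotes the total number of valid encodings, the optimal adversarial success probability satisfies $\hat\epsilon\ge \frac{1}{a}$.
   Context: Let $\mathcal{G}$ be a finite additive abelian group of order $n\ge 2$ and $\mathcal{S}$ a set of $m$ sources. An AMD code consists of pairwise disjoint nonempty subsets $A(s)\subseteq\mathcal{G}$ ($s\in\mathcal{S}$) of valid encodings and a (possibly randomized) public encoding function $E$ mapping each source $s$ to some $g\in A(s)$ according to a probability distribution $\Pr[E(s)=g]$ on $A(s)$. Write $a_s=|A(s)|$ and $a=\sum_{s}a_s$. Weak security game: the adversary, knowing the code, chooses $\Delta\in\mathcal{G}\setminus\{0\}$ according to a (possibly randomized) strategy $\sigma$; then a source $s$ is chosen uniformly at random from $\mathcal{S}$ and encoded as $g=E(s)$; the adversary wins iff $g+\Delta\in A(s')$ for some $s'\ne s$. $\epsilon_\sigma$ is the winning probability of $\sigma$ and $\hat\epsilon=\max_\sigma\epsilon_\sigma$.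
   Formalization: The encoding probabilities $\Pr[E(s)=g]$ are rational, and the strategy $\sigma$ reaching the bound is taken with rational probabilities. -}

module Defs where

open import Data.Nat using (ℕ; zero; suc)
import Data.Nat
open import Data.Fin using (Fin; zero; suc)
open import Data.Fin.Subset using (Subset; _∈_; ∣_∣)
open import Data.Fin.Subset.Properties using (_∈?_)
open import Data.Bool using (Bool; true; false; _∨_; _∧_; not)
open import Data.Integer using (+_)
open import Data.Rational using (ℚ; 0ℚ; 1ℚ; _/_; _+_; _*_)
open import Relation.Nullary.Decidable using (⌊_⌋)
open import Data.Fin.Properties using () renaming (_≟_ to _≟ᶠ_)

Σ : (n : ℕ) → (Fin n → ℚ) → ℚ
Σ zero    f = 0ℚ
Σ (suc n) f = f zero + Σ n (λ i → f (suc i))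

Σℕ : (n : ℕ) → (Fin n → ℕ) → ℕ
Σℕ zero    f = 0
Σℕ (suc n) f = f zero Data.Nat.+ Σℕ n (λ i → f (suc i))

anyᶠ : (n : ℕ) → (Fin n → Bool) → Bool
anyᶠ zero    b = false
anyᶠ (suc n) b = b zero ∨ anyᶠ n (λ i → b (suc i))

-- 1/k as a rational (only used for k ≥ 1; the value at 0 is irrelevant).
1/ℕ : ℕ → ℚ
1/ℕ zero    = 0ℚ
1/ℕ (suc k) = + 1 / suc k

[_]ℚ : Bool → ℚ
[ true  ]ℚ = 1ℚ
[ false ]ℚ = 0ℚ

totalEncodings : {n : ℕ} (m : ℕ) → (Fin m → Subset n) → ℕ
totalEncodings m A = Σℕ m (λ s → ∣ A s ∣)

wins : {n : ℕ} (m : ℕ) (_⊕_ : Fin n → Fin n → Fin n) (A : Fin m → Subset n)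
       (s : Fin m) (g Δ : Fin n) → Bool
wins m _⊕_ A s g Δ =
  anyᶠ m (λ s' → not ⌊ s' ≟ᶠ s ⌋ ∧ ⌊ (g ⊕ Δ) ∈? A s' ⌋)

-- success probability of the (randomized) strategy σ (σ Δ = Pr[adversary picks Δ]),
-- for encoding distribution P (P s g = Pr[E(s) = g]), source chosen uniformly:
--   ε_σ = Σ_Δ σ(Δ) · Σ_s (1/m) · Σ_g P(s,g) · [g + Δ ∈ A(s') for some s' ≠ s]
successProb : {n : ℕ} (m : ℕ) (_⊕_ : Fin n → Fin n → Fin n) (A : Fin m → Subset n)
              (P : Fin m → Fin n → ℚ) (σ : Fin n → ℚ) → ℚ
successProb {n} m _⊕_ A P σ =
  Σ n (λ Δ → σ Δ * Σ m (λ s → 1/ℕ m * Σ n (λ g → P s g * [ wins m _⊕_ A s g Δ ]ℚ)))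

-- Let (s⋆, g⋆) maximise Pr[E(s) = g]. The m rows of the encoding distribution each sum to 1 and
-- are supported on the a valid encodings, so p⋆ = Pr[E(s⋆) = g⋆] ≥ m/a; in particular g⋆ is a
-- valid encoding of s⋆. Take a valid encoding g₁ of another source s₁ and let the adversary always
-- play Δ₀ = g₁ − g⋆, which is nonzero because the sets of valid encodings are disjoint. It wins at
-- least when s⋆ is drawn and encoded as g⋆, which happens with probability p⋆/m ≥ 1/a.
module Submission where

open import Defs
open import Data.Nat using (ℕ; _≤_)
open import Data.Fin using (Fin)
open import Data.Fin.Subset using (Subset; _∈_; _∉_)
open import Data.Rational using (ℚ; 0ℚ; 1ℚ) renaming (_≤_ to _≤ℚ_)
open import Data.Product using (Σ-syntax; ∃; ∃-syntax; _×_)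
open import Relation.Binary.PropositionalEquality using (_≡_; _≢_)
open import Algebra.Structures using (IsAbelianGroup)

import Data.Nat as ℕ
open import Data.Nat using (zero; suc; s≤s)
open import Data.Nat.Coprimality using (1-coprimeTo) renaming (sym to coprime-sym)
import Data.Integer as ℤ
import Data.Integer.Properties as ℤ
open import Data.Rational using (mkℚ; _+_; _*_; nonNegative)
import Data.Rational.Properties as ℚ
open import Data.Rational.Solver using (module +-*-Solver)
open import Data.Fin using (zero; suc; punchIn)
open import Data.Fin.Properties using (punchInᵢ≢i) renaming (_≟_ to _≟ᶠ_)
open import Data.Fin.Subset using (∣_∣)
open import Data.Fin.Subset.Properties using (_∈?_)
open import Data.Vec using (lookup; _∷_; [])
open import Data.Vec.Properties using ([]=⇒lookup)
open import Data.List using (allFin; cartesianProduct)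
open import Data.List.Membership.Propositional.Properties using (∈-allFin; ∈-cartesianProduct⁺)
import Data.List.Relation.Unary.All as All
open import Relation.Binary.Bundles using (DecTotalOrder)
open import Data.List.Extrema (DecTotalOrder.totalOrder ℚ.≤-decTotalOrder) using (argmax; f[xs]≤f[argmax])
open import Data.Bool using (Bool; true; false; not; _∧_)
open import Data.Bool.Properties using (∨-zeroʳ)
open import Data.Product using (_,_; proj₁; proj₂; uncurry)
open import Data.Empty using (⊥-elim)
open import Function using (_∘_)
open import Relation.Nullary using (¬_; Dec)
open import Relation.Nullary.Decidable using (⌊_⌋; isYes≗does; dec-true; dec-false; decidable-stable)
open import Relation.Binary.PropositionalEquality
  using (refl; sym; trans; cong; cong₂; subst; subst₂; module ≡-Reasoning)
open import Algebra.Bundles using (Group)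
open import Algebra.Structures using (IsGroup)
import Algebra.Properties.Group as GroupProperties

ℕ→ℚ : ℕ → ℚ
ℕ→ℚ k = mkℚ (ℤ.+ k) 0 (coprime-sym (1-coprimeTo k))

ℕ→ℚ-suc : ∀ k → ℕ→ℚ (suc k) ≡ 1ℚ + ℕ→ℚ k
ℕ→ℚ-suc k = sym (trans
  (ℚ./-cong {p₂ = ℤ.+ suc k} (cong (ℤ._+_ (ℤ.+ 1)) (ℤ.*-identityʳ (ℤ.+ k))) refl)
  (ℚ.normalize-coprime (coprime-sym (1-coprimeTo (suc k)))))

ℕ→ℚ-+ : ∀ j k → ℕ→ℚ (j ℕ.+ k) ≡ ℕ→ℚ j + ℕ→ℚ k
ℕ→ℚ-+ zero    k = sym (ℚ.+-identityˡ (ℕ→ℚ k))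
ℕ→ℚ-+ (suc j) k = begin
  ℕ→ℚ (suc (j ℕ.+ k))         ≡⟨ ℕ→ℚ-suc (j ℕ.+ k) ⟩
  1ℚ + ℕ→ℚ (j ℕ.+ k)          ≡⟨ cong (1ℚ +_) (ℕ→ℚ-+ j k) ⟩
  1ℚ + (ℕ→ℚ j + ℕ→ℚ k)        ≡⟨ ℚ.+-assoc 1ℚ (ℕ→ℚ j) (ℕ→ℚ k) ⟨
  (1ℚ + ℕ→ℚ j) + ℕ→ℚ k        ≡⟨ cong (_+ ℕ→ℚ k) (ℕ→ℚ-suc j) ⟨
  ℕ→ℚ (suc j) + ℕ→ℚ k         ∎
  where open ≡-Reasoning

ℕ→ℚ-suc≰0 : ∀ k → ¬ (ℕ→ℚ (suc k) ≤ℚ 0ℚ)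
ℕ→ℚ-suc≰0 k k≤0 = ℚ.<-irrefl refl (ℚ.<-≤-trans (ℚ.positive⁻¹ (ℕ→ℚ (suc k))) k≤0)

ℕ→ℚ-suc≤*⇒≢0 : ∀ k a {p} → ℕ→ℚ (suc k) ≤ℚ ℕ→ℚ a * p → p ≢ 0ℚ
ℕ→ℚ-suc≤*⇒≢0 k a k≤a*0 refl = ℕ→ℚ-suc≰0 k (subst (ℕ→ℚ (suc k) ≤ℚ_) (ℚ.*-zeroʳ (ℕ→ℚ a)) k≤a*0)

1/ℕ-nonNeg : ∀ k → 0ℚ ≤ℚ 1/ℕ k
1/ℕ-nonNeg zero    = ℚ.≤-refl
1/ℕ-nonNeg (suc k) = ℚ.nonNegative⁻¹ _ {{ℚ.normalize-nonNeg 1 (suc k)}}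

1/ℕ-inverseˡ : ∀ k → 1/ℕ (suc k) * ℕ→ℚ (suc k) ≡ 1ℚ
1/ℕ-inverseˡ k =
  trans (cong (_* ℕ→ℚ (suc k)) (ℚ.normalize-coprime (1-coprimeTo (suc k))))
        (ℚ.*-inverseˡ (ℕ→ℚ (suc k)))

*-nonNeg : ∀ {p q} → 0ℚ ≤ℚ p → 0ℚ ≤ℚ q → 0ℚ ≤ℚ p * q
*-nonNeg {p} {q} 0≤p 0≤q =
  ℚ.nonNegative⁻¹ _ {{ℚ.nonNeg*nonNeg⇒nonNeg p {{nonNegative 0≤p}} q {{nonNegative 0≤q}}}}

*-monoˡ-≤-nonNeg : ∀ {r p q} → 0ℚ ≤ℚ r → p ≤ℚ q → r * p ≤ℚ r * q
*-monoˡ-≤-nonNeg {r} 0≤r = ℚ.*-monoˡ-≤-nonNeg r {{nonNegative 0≤r}}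

[]ℚ-nonNeg : ∀ b → 0ℚ ≤ℚ [ b ]ℚ
[]ℚ-nonNeg true  = ℚ.nonNegative⁻¹ 1ℚ
[]ℚ-nonNeg false = ℚ.≤-refl

ℕ→ℚ≤*⇒1/ℕ≤1/ℕ* : ∀ m a {p} → ℕ→ℚ (suc m) ≤ℚ ℕ→ℚ a * p → 1/ℕ a ≤ℚ 1/ℕ (suc m) * p
ℕ→ℚ≤*⇒1/ℕ≤1/ℕ* m zero {p} m≤0*p =
  ⊥-elim (ℕ→ℚ-suc≰0 m (subst (ℕ→ℚ (suc m) ≤ℚ_) (ℚ.*-zeroˡ p) m≤0*p))
ℕ→ℚ≤*⇒1/ℕ≤1/ℕ* m (suc a) {p} m≤a*p = begin
  1/a                            ≡⟨ ℚ.*-identityʳ 1/a ⟨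
  1/a * 1ℚ                       ≡⟨ cong (1/a *_) (1/ℕ-inverseˡ m) ⟨
  1/a * (1/m * M)                ≤⟨ *-monoˡ-≤-nonNeg 0≤1/a (*-monoˡ-≤-nonNeg 0≤1/m m≤a*p) ⟩
  1/a * (1/m * (A * p))          ≡⟨ solve 5 (λ x y u v w → x :* (y :* (v :* w)) := (x :* v) :* (y :* w))
                                          refl 1/a 1/m M A p ⟩
  (1/a * A) * (1/m * p)          ≡⟨ cong (_* (1/m * p)) (1/ℕ-inverseˡ a) ⟩
  1ℚ * (1/m * p)                 ≡⟨ ℚ.*-identityˡ (1/m * p) ⟩
  1/m * p                        ∎
  where
  open ℚ.≤-Reasoning
  open +-*-Solver
  1/a = 1/ℕ (suc a)
  1/m = 1/ℕ (suc m)
  A = ℕ→ℚ (suc a)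
  M = ℕ→ℚ (suc m)
  0≤1/a = 1/ℕ-nonNeg (suc a)
  0≤1/m = 1/ℕ-nonNeg (suc m)

Σ-cong : ∀ n {f g : Fin n → ℚ} → (∀ i → f i ≡ g i) → Σ n f ≡ Σ n g
Σ-cong zero    f≡g = refl
Σ-cong (suc n) f≡g = cong₂ _+_ (f≡g zero) (Σ-cong n (f≡g ∘ suc))

Σ-mono-≤ : ∀ n {f g : Fin n → ℚ} → (∀ i → f i ≤ℚ g i) → Σ n f ≤ℚ Σ n g
Σ-mono-≤ zero    f≤g = ℚ.≤-refl
Σ-mono-≤ (suc n) f≤g = ℚ.+-mono-≤ (f≤g zero) (Σ-mono-≤ n (f≤g ∘ suc))

Σ-nonNeg : ∀ n {f : Fin n → ℚ} → (∀ i → 0ℚ ≤ℚ f i) → 0ℚ ≤ℚ Σ n f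
Σ-nonNeg zero    0≤f = ℚ.≤-refl
Σ-nonNeg (suc n) 0≤f = ℚ.+-mono-≤ (0≤f zero) (Σ-nonNeg n (0≤f ∘ suc))

f≤Σf : ∀ n {f : Fin n → ℚ} → (∀ i → 0ℚ ≤ℚ f i) → ∀ j → f j ≤ℚ Σ n f
f≤Σf (suc n) {f} 0≤f zero =
  subst (_≤ℚ Σ (suc n) f) (ℚ.+-identityʳ (f zero))
        (ℚ.+-mono-≤ (ℚ.≤-refl {f zero}) (Σ-nonNeg n (0≤f ∘ suc)))
f≤Σf (suc n) {f} 0≤f (suc j) =
  subst (_≤ℚ Σ (suc n) f) (ℚ.+-identityˡ (f (suc j)))
        (ℚ.+-mono-≤ (0≤f zero) (f≤Σf n (0≤f ∘ suc) j))

Σ-const-0 : ∀ n → Σ n (λ _ → 0ℚ) ≡ 0ℚ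
Σ-const-0 zero    = refl
Σ-const-0 (suc n) = trans (cong (0ℚ +_) (Σ-const-0 n)) (ℚ.+-identityˡ 0ℚ)

Σ-const-1 : ∀ n → Σ n (λ _ → 1ℚ) ≡ ℕ→ℚ n
Σ-const-1 zero    = refl
Σ-const-1 (suc n) = trans (cong (1ℚ +_) (Σ-const-1 n)) (sym (ℕ→ℚ-suc n))

Σ-ℕ→ℚ-* : ∀ n (f : Fin n → ℕ) c → Σ n (λ i → ℕ→ℚ (f i) * c) ≡ ℕ→ℚ (Σℕ n f) * c
Σ-ℕ→ℚ-* zero    f c = sym (ℚ.*-zeroˡ c)
Σ-ℕ→ℚ-* (suc n) f c = begin
  ℕ→ℚ (f zero) * c + Σ n (λ i → ℕ→ℚ (f (suc i)) * c) ≡⟨ cong (ℕ→ℚ (f zero) * c +_) (Σ-ℕ→ℚ-* n (f ∘ suc) c) ⟩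
  ℕ→ℚ (f zero) * c + ℕ→ℚ rest * c                     ≡⟨ ℚ.*-distribʳ-+ c (ℕ→ℚ (f zero)) (ℕ→ℚ rest) ⟨
  (ℕ→ℚ (f zero) + ℕ→ℚ rest) * c                       ≡⟨ cong (_* c) (ℕ→ℚ-+ (f zero) rest) ⟨
  ℕ→ℚ (Σℕ (suc n) f) * c                               ∎
  where
  open ≡-Reasoning
  rest = Σℕ n (f ∘ suc)

Σ-indicator-* : ∀ {n} (p : Subset n) c → Σ n (λ g → [ lookup p g ]ℚ * c) ≡ ℕ→ℚ ∣ p ∣ * c
Σ-indicator-* []          c = sym (ℚ.*-zeroˡ c)
Σ-indicator-* (true ∷ p)  c = begin
  1ℚ * c + Σ _ (λ g → [ lookup p g ]ℚ * c) ≡⟨ cong (1ℚ * c +_) (Σ-indicator-* p c) ⟩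
  1ℚ * c + ℕ→ℚ ∣ p ∣ * c                   ≡⟨ ℚ.*-distribʳ-+ c 1ℚ (ℕ→ℚ ∣ p ∣) ⟨
  (1ℚ + ℕ→ℚ ∣ p ∣) * c                     ≡⟨ cong (_* c) (ℕ→ℚ-suc ∣ p ∣) ⟨
  ℕ→ℚ (suc ∣ p ∣) * c                      ∎
  where open ≡-Reasoning
Σ-indicator-* (false ∷ p) c = begin
  0ℚ * c + Σ _ (λ g → [ lookup p g ]ℚ * c) ≡⟨ cong₂ _+_ (ℚ.*-zeroˡ c) (Σ-indicator-* p c) ⟩
  0ℚ + ℕ→ℚ ∣ p ∣ * c                       ≡⟨ ℚ.+-identityˡ _ ⟩
  ℕ→ℚ ∣ p ∣ * c                            ∎
  where open ≡-Reasoning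

δ : ∀ {n} → Fin n → Fin n → ℚ
δ zero    zero    = 1ℚ
δ zero    (suc _) = 0ℚ
δ (suc _) zero    = 0ℚ
δ (suc i) (suc j) = δ i j

δ-nonNeg : ∀ {n} (i j : Fin n) → 0ℚ ≤ℚ δ i j
δ-nonNeg zero    zero    = ℚ.nonNegative⁻¹ 1ℚ
δ-nonNeg zero    (suc j) = ℚ.≤-refl
δ-nonNeg (suc i) zero    = ℚ.≤-refl
δ-nonNeg (suc i) (suc j) = δ-nonNeg i j

δ-≢ : ∀ {n} (i j : Fin n) → i ≢ j → δ i j ≡ 0ℚ
δ-≢ zero    zero    i≢j = ⊥-elim (i≢j refl)
δ-≢ zero    (suc j) i≢j = refl
δ-≢ (suc i) zero    i≢j = refl
δ-≢ (suc i) (suc j) i≢j = δ-≢ i j (i≢j ∘ cong suc)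

Σ-δ-* : ∀ n (j : Fin n) (f : Fin n → ℚ) → Σ n (λ i → δ i j * f i) ≡ f j
Σ-δ-* (suc n) zero    f = trans
  (cong₂ _+_ (ℚ.*-identityˡ (f zero)) (Σ-cong n (λ i → ℚ.*-zeroˡ (f (suc i)))))
  (trans (cong (f zero +_) (Σ-const-0 n)) (ℚ.+-identityʳ (f zero)))
Σ-δ-* (suc n) (suc j) f =
  trans (cong₂ _+_ (ℚ.*-zeroˡ (f zero)) (Σ-δ-* n j (f ∘ suc))) (ℚ.+-identityˡ (f (suc j)))

Σ-δ : ∀ n (j : Fin n) → Σ n (λ i → δ i j) ≡ 1ℚ
Σ-δ n j = trans (Σ-cong n (λ i → sym (ℚ.*-identityʳ (δ i j)))) (Σ-δ-* n j (λ _ → 1ℚ))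

≤-indicator-* : ∀ {n} (p : Subset n) {f : Fin n → ℚ} {c} →
                (∀ g → f g ≤ℚ c) → (∀ g → g ∉ p → f g ≡ 0ℚ) →
                ∀ g → f g ≤ℚ [ lookup p g ]ℚ * c
≤-indicator-* p {f} {c} f≤c f-supp g with lookup p g in eq
... | true  = subst (f g ≤ℚ_) (sym (ℚ.*-identityˡ c)) (f≤c g)
... | false = subst₂ _≤ℚ_ (sym (f-supp g g∉p)) (sym (ℚ.*-zeroˡ c)) ℚ.≤-refl
  where
  g∉p : g ∉ p
  g∉p g∈p with () ← trans (sym ([]=⇒lookup g∈p)) eq

ℕ→ℚ≤totalEncodings* : ∀ {n} m (A : Fin m → Subset n) (P : Fin m → Fin n → ℚ) {c} →
                      (∀ s g → g ∉ A s → P s g ≡ 0ℚ) → (∀ s → Σ n (P s) ≡ 1ℚ) →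
                      (∀ s g → P s g ≤ℚ c) → ℕ→ℚ m ≤ℚ ℕ→ℚ (totalEncodings m A) * c
ℕ→ℚ≤totalEncodings* {n} m A P {c} P-supp P-sum P≤c = begin
  ℕ→ℚ m                                           ≡⟨ Σ-const-1 m ⟨
  Σ m (λ _ → 1ℚ)                                  ≡⟨ Σ-cong m P-sum ⟨
  Σ m (λ s → Σ n (P s))                           ≤⟨ Σ-mono-≤ m (Σ-mono-≤ n ∘ P≤indicator) ⟩
  Σ m (λ s → Σ n (λ g → [ lookup (A s) g ]ℚ * c)) ≡⟨ Σ-cong m (λ s → Σ-indicator-* (A s) c) ⟩
  Σ m (λ s → ℕ→ℚ ∣ A s ∣ * c)                     ≡⟨ Σ-ℕ→ℚ-* m (λ s → ∣ A s ∣) c ⟩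
  ℕ→ℚ (totalEncodings m A) * c                    ∎
  where
  open ℚ.≤-Reasoning
  P≤indicator : ∀ s g → P s g ≤ℚ [ lookup (A s) g ]ℚ * c
  P≤indicator s = ≤-indicator-* (A s) (P≤c s) (P-supp s)

argmax₂ : ∀ {m n} → (Fin m → Fin n → ℚ) → Fin m × Fin n → Fin m × Fin n
argmax₂ {m} {n} f ⊥ = argmax (uncurry f) ⊥ (cartesianProduct (allFin m) (allFin n))

f≤f[argmax₂] : ∀ {m n} (f : Fin m → Fin n → ℚ) ⊥ s g → f s g ≤ℚ uncurry f (argmax₂ f ⊥)
f≤f[argmax₂] {m} {n} f ⊥ s g =
  All.lookup (f[xs]≤f[argmax] ⊥ (cartesianProduct (allFin m) (allFin n)))
             (∈-cartesianProduct⁺ (∈-allFin s) (∈-allFin g))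

heavyValidEncoding : ∀ {n} m (A : Fin (suc m) → Subset (suc n)) (P : Fin (suc m) → Fin (suc n) → ℚ) →
  (∀ s g → g ∉ A s → P s g ≡ 0ℚ) → (∀ s → Σ (suc n) (P s) ≡ 1ℚ) →
  ∃[ s ] ∃[ g ] (g ∈ A s × ℕ→ℚ (suc m) ≤ℚ ℕ→ℚ (totalEncodings (suc m) A) * P s g)
heavyValidEncoding m A P P-supp P-sum = s⋆ , g⋆ , g⋆∈A , m≤a*p⋆
  where
  s⋆ = proj₁ (argmax₂ P (zero , zero))
  g⋆ = proj₂ (argmax₂ P (zero , zero))
  m≤a*p⋆ : ℕ→ℚ (suc m) ≤ℚ ℕ→ℚ (totalEncodings (suc m) A) * P s⋆ g⋆
  m≤a*p⋆ = ℕ→ℚ≤totalEncodings* (suc m) A P P-supp P-sum (f≤f[argmax₂] P (zero , zero))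
  g⋆∈A : g⋆ ∈ A s⋆
  g⋆∈A = decidable-stable (g⋆ ∈? A s⋆)
           (ℕ→ℚ-suc≤*⇒≢0 m (totalEncodings (suc m) A) m≤a*p⋆ ∘ P-supp s⋆ g⋆)

anyᶠ-witness : ∀ k (b : Fin k → Bool) j → b j ≡ true → anyᶠ k b ≡ true
anyᶠ-witness (suc k) b zero    bj≡true rewrite bj≡true = refl
anyᶠ-witness (suc k) b (suc j) bj≡true
  rewrite anyᶠ-witness k (b ∘ suc) j bj≡true = ∨-zeroʳ (b zero)

isYes-true : ∀ {X : Set} (x? : Dec X) → X → ⌊ x? ⌋ ≡ true
isYes-true x? x = trans (isYes≗does x?) (dec-true x? x)

isYes-false : ∀ {X : Set} (x? : Dec X) → ¬ X → ⌊ x? ⌋ ≡ false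
isYes-false x? ¬x = trans (isYes≗does x?) (dec-false x? ¬x)

wins-witness : ∀ {n} m (_⊕_ : Fin n → Fin n → Fin n) (A : Fin m → Subset n) s g Δ s' →
               s' ≢ s → (g ⊕ Δ) ∈ A s' → wins m _⊕_ A s g Δ ≡ true
wins-witness m _⊕_ A s g Δ s' s'≢s hit = anyᶠ-witness m _ s'
  (cong₂ (λ b c → not b ∧ c) (isYes-false (s' ≟ᶠ s) s'≢s) (isYes-true ((g ⊕ Δ) ∈? A s') hit))

winning-encoding≤successProb :
  ∀ {n} m (_⊕_ : Fin n → Fin n → Fin n) (A : Fin m → Subset n) (P : Fin m → Fin n → ℚ) →
  (∀ s g → 0ℚ ≤ℚ P s g) → ∀ s g Δ → wins m _⊕_ A s g Δ ≡ true →
  1/ℕ m * P s g ≤ℚ successProb m _⊕_ A P (λ Δ' → δ Δ' Δ)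
winning-encoding≤successProb {n} m _⊕_ A P P≥0 s g Δ win = begin
  1/ℕ m * P s g                       ≡⟨ cong (1/ℕ m *_) (ℚ.*-identityʳ (P s g)) ⟨
  1/ℕ m * (P s g * 1ℚ)                ≡⟨ cong (λ b → 1/ℕ m * (P s g * [ b ]ℚ)) win ⟨
  1/ℕ m * gain s g                    ≤⟨ *-monoˡ-≤-nonNeg (1/ℕ-nonNeg m) (f≤Σf n (gain-nonNeg s) g) ⟩
  1/ℕ m * Σ n (gain s)                ≤⟨ f≤Σf m (λ s' → *-nonNeg (1/ℕ-nonNeg m) (Σ-nonNeg n (gain-nonNeg s'))) s ⟩
  Σ m (λ s' → 1/ℕ m * Σ n (gain s'))  ≡⟨ Σ-δ-* n Δ _ ⟨
  successProb m _⊕_ A P (λ Δ' → δ Δ' Δ) ∎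
  where
  open ℚ.≤-Reasoning
  gain : Fin m → Fin n → ℚ
  gain s' g' = P s' g' * [ wins m _⊕_ A s' g' Δ ]ℚ
  gain-nonNeg : ∀ s' g' → 0ℚ ≤ℚ gain s' g'
  gain-nonNeg s' g' = *-nonNeg (P≥0 s' g') ([]ℚ-nonNeg (wins m _⊕_ A s' g' Δ))

difference-wins : ∀ {n} {_⊕_ : Fin n → Fin n → Fin n} {e ⊖_} → IsGroup _≡_ _⊕_ e ⊖_ →
                  ∀ m (A : Fin m → Subset n) → (∀ s s' → s ≢ s' → ∀ g → g ∈ A s → g ∉ A s') →
                  ∀ {s s' g g'} → s' ≢ s → g ∈ A s → g' ∈ A s' →
                  (⊖ g) ⊕ g' ≢ e × wins m _⊕_ A s g ((⊖ g) ⊕ g') ≡ true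
difference-wins {_⊕_ = _⊕_} {e} G m A disjoint {s} {s'} {g} {g'} s'≢s g∈A g'∈A =
  Δ≢e , wins-witness m _⊕_ A s g Δ s' s'≢s (subst (_∈ A s') (sym g⊕Δ≡g') g'∈A)
  where
  group : Group _ _
  group = record { isGroup = G }
  open Group group using (_\\_; identityʳ)
  open GroupProperties group using (\\-leftDividesˡ)
  Δ = g \\ g'
  g⊕Δ≡g' : g ⊕ Δ ≡ g'
  g⊕Δ≡g' = \\-leftDividesˡ g g'
  Δ≢e : Δ ≢ e
  Δ≢e Δ≡e = disjoint s s' (s'≢s ∘ sym) g g∈A (subst (_∈ A s') g'≡g g'∈A)
    where
    g'≡g : g' ≡ g
    g'≡g = trans (sym g⊕Δ≡g') (trans (cong (g ⊕_) Δ≡e) (identityʳ g))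

mainTheorem5 : (n : ℕ) → 2 ≤ n →
    (_⊕_ : Fin n → Fin n → Fin n) (e : Fin n) (⊖_ : Fin n → Fin n) →
    IsAbelianGroup _≡_ _⊕_ e ⊖_ →
    (m : ℕ) → 2 ≤ m →
    (A : Fin m → Subset n) →
    (∀ s → ∃[ g ] g ∈ A s) →
    (∀ s s' → s ≢ s' → ∀ g → g ∈ A s → g ∉ A s') →
    (P : Fin m → Fin n → ℚ) →
    (∀ s g → 0ℚ ≤ℚ P s g) →
    (∀ s g → g ∉ A s → P s g ≡ 0ℚ) →
    (∀ s → Σ n (P s) ≡ 1ℚ) →
    Σ[ σ ∈ (Fin n → ℚ) ]
    ((∀ Δ → 0ℚ ≤ℚ σ Δ) × σ e ≡ 0ℚ × Σ n σ ≡ 1ℚ ×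
    1/ℕ (totalEncodings m A) ≤ℚ successProb m _⊕_ A P σ)
mainTheorem5 n@(suc _) _ _⊕_ e ⊖_ G m@(suc (suc m′)) (s≤s (s≤s _)) A nonempty disjoint P P≥0 P-supp P-sum =
  (λ Δ → δ Δ Δ₀) , (λ Δ → δ-nonNeg Δ Δ₀) , δ-≢ e Δ₀ (proj₁ attack ∘ sym) , Σ-δ n Δ₀ ,
  ℚ.≤-trans (ℕ→ℚ≤*⇒1/ℕ≤1/ℕ* (suc m′) (totalEncodings m A) m≤a*p⋆)
            (winning-encoding≤successProb m _⊕_ A P P≥0 s⋆ g⋆ Δ₀ (proj₂ attack))
  where
  heavy = heavyValidEncoding (suc m′) A P P-supp P-sum
  s⋆ = proj₁ heavy
  g⋆ = proj₁ (proj₂ heavy)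
  g⋆∈A = proj₁ (proj₂ (proj₂ heavy))
  m≤a*p⋆ = proj₂ (proj₂ (proj₂ heavy))
  s₁ = punchIn s⋆ zero
  g₁ = proj₁ (nonempty s₁)
  Δ₀ = (⊖ g⋆) ⊕ g₁
  attack = difference-wins (IsAbelianGroup.isGroup G) m A disjoint
                           (punchInᵢ≢i s⋆ zero) g⋆∈A (proj₂ (nonempty s₁))
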